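{- If $m,b,k,w$ are positive integers such that $b\ge6$ and $m\le k\le w/2$, then $(m-1)(b+1)^w\le k\cdot 2^{b(w-m)}$. -}

module Defs where

{-# OPTIONS --safe #-}
module Submission where

-- Since m - 1 < k it suffices to show (b + 1)^w ≤ 2^(b(w - m)). The hypothesis
-- 2m ≤ w gives w ≤ 2(w - m), so this follows from (b + 1)^2 ≤ 2^b, which holds
-- for b ≥ 6 by induction: 7^2 ≤ 2^6, and the left side at most doubles at each step.

open import Defs
open import Data.Nat using (ℕ; suc; _+_; _*_; _∸_; _^_; _≤_; _<_; _≤′_; ≤′-refl; ≤′-step; s≤s; z≤n; NonZero)
open import Data.Nat.Properties
open import Data.Nat.Tactic.RingSolver using (solve-∀)
open import Relation.Binary.PropositionalEquality using (_≡_; cong; subst)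
open import Relation.Nullary.Decidable using (toWitness)

2*m≡m+m : ∀ m → 2 * m ≡ m + m
2*m≡m+m m = cong (m +_) (*-identityˡ m)

w≤2*[w∸m] : ∀ m {w} → 2 * m ≤ w → w ≤ 2 * (w ∸ m)
w≤2*[w∸m] m {w} 2m≤w = begin
  w                 ≡⟨ m∸n+n≡m (m+n≤o⇒n≤o m m+m≤w) ⟨
  (w ∸ m) + m       ≤⟨ +-monoʳ-≤ (w ∸ m) (m+n≤o⇒m≤o∸n m m+m≤w) ⟩
  (w ∸ m) + (w ∸ m) ≡⟨ 2*m≡m+m (w ∸ m) ⟨
  2 * (w ∸ m)       ∎
  where
  open ≤-Reasoning
  m+m≤w : m + m ≤ w
  m+m≤w = subst (_≤ w) (2*m≡m+m m) 2m≤w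

[2+b]²≤2*[1+b]² : ∀ {b} → 2 ≤ b → (2 + b) * (2 + b) ≤ 2 * ((1 + b) * (1 + b))
[2+b]²≤2*[1+b]² {b@(suc _)} 2≤b = +-cancelʳ-≤ 2 _ _ (begin
  (2 + b) * (2 + b) + 2       ≤⟨ +-monoʳ-≤ ((2 + b) * (2 + b)) (≤-trans 2≤b (m≤m*n b b)) ⟩
  (2 + b) * (2 + b) + b * b   ≡⟨ identity b ⟩
  2 * ((1 + b) * (1 + b)) + 2 ∎)
  where
  open ≤-Reasoning
  identity : ∀ b → (2 + b) * (2 + b) + b * b ≡ 2 * ((1 + b) * (1 + b)) + 2
  identity = solve-∀

[1+b]²≤2^b : ∀ {b} → 6 ≤ b → (1 + b) * (1 + b) ≤ 2 ^ b
[1+b]²≤2^b 6≤b = go (≤⇒≤′ 6≤b)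
  where
  go : ∀ {b} → 6 ≤′ b → (1 + b) * (1 + b) ≤ 2 ^ b
  go ≤′-refl         = toWitness {a? = 49 ≤? 64} _
  go (≤′-step 6≤′b) =
    ≤-trans ([2+b]²≤2*[1+b]² (≤-trans (s≤s (s≤s z≤n)) (≤′⇒≤ 6≤′b)))
            (*-monoʳ-≤ 2 (go 6≤′b))

x^w≤y^d : ∀ {x y w d} .{{_ : NonZero x}} → x * x ≤ y → w ≤ 2 * d → x ^ w ≤ y ^ d
x^w≤y^d {x} {y} {w} {d} x²≤y w≤2d = begin
  x ^ w         ≤⟨ ^-monoʳ-≤ x w≤2d ⟩
  x ^ (2 * d)   ≡⟨ ^-*-assoc x 2 d ⟨
  (x ^ 2) ^ d   ≡⟨ cong (λ z → (x * z) ^ d) (*-identityʳ x) ⟩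
  (x * x) ^ d   ≤⟨ ^-monoˡ-≤ d x²≤y ⟩
  y ^ d         ∎
  where open ≤-Reasoning

lemma5 : (m b k w : ℕ) → 0 < m → 0 < b → 0 < k → 0 < w →
           6 ≤ b → m ≤ k → 2 * k ≤ w →
           (m ∸ 1) * (b + 1) ^ w ≤ k * 2 ^ (b * (w ∸ m))
lemma5 m b k w _ _ _ _ 6≤b m≤k 2k≤w = begin
  (m ∸ 1) * (b + 1) ^ w   ≤⟨ *-monoˡ-≤ ((b + 1) ^ w) (≤-trans (m∸n≤m m 1) m≤k) ⟩
  k * (b + 1) ^ w         ≡⟨ cong (λ x → k * x ^ w) (+-comm b 1) ⟩
  k * (1 + b) ^ w         ≤⟨ *-monoʳ-≤ k (x^w≤y^d {d = w ∸ m} ([1+b]²≤2^b 6≤b) (w≤2*[w∸m] m 2m≤w)) ⟩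
  k * (2 ^ b) ^ (w ∸ m)   ≡⟨ cong (k *_) (^-*-assoc 2 b (w ∸ m)) ⟩
  k * 2 ^ (b * (w ∸ m))   ∎
  where
  open ≤-Reasoning
  2m≤w : 2 * m ≤ w
  2m≤w = ≤-trans (*-monoʳ-≤ 2 m≤k) 2k≤w
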